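{- Let $n\ge 2$ and $1\le k\le n$, and let $A(n,k)$ be the number of arithmetical structures $(\mathbf{d},\mathbf{r})$ on the path $\mathcal{P}_n$ with $\mathbf{r}(1)=k$. Then \[A(n,k)=B(n-2,n-k)=\frac{k-1}{n-1}\binom{2n-2-k}{n-2}.\]
   Context: $\mathcal{P}_n$ is the path graph with vertices $1,\dots,n$ and edges $\{i,i+1\}$, with adjacency matrix $A$. An arithmetical structure on $\mathcal{P}_n$ is a pair $(\mathbf{d},\mathbf{r})$ of positive integer vectors in $\mathbb{Z}^n$ with $\mathbf{r}$ primitive (gcd of entries $1$) and $(\operatorname{diag}(\mathbf{d})-A)\mathbf{r}=\mathbf{0}$. $\mathbf{r}(1)=\#\{i: r_i=1\}$. For nonnegative integers $k,\ell$, the ballot number $B(k,\ell)$ is the number of lattice paths from $(0,0)$ to $(k,\ell)$ using unit east and north steps that never go above the line $y=x$ (so $B(k,\ell)=0$ if $\ell>k$). -}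

module Defs where

open import Data.Nat using (ℕ; zero; suc; _+_; _*_; _∸_; _≤_; _≤ᵇ_; _≡ᵇ_)
open import Data.Nat.GCD using (gcd)
open import Data.Nat.Properties using (_≟_)
open import Data.Bool using (Bool; true; false; _∧_)
open import Data.Fin using (Fin; toℕ)
open import Data.Vec using (Vec; lookup; tabulate; toList)
import Data.Vec as V
open import Data.List using (List; []; _∷_; length; filter; map; foldr; concat)
open import Data.List.Relation.Unary.Unique.Propositional using (Unique)
open import Data.List.Membership.Propositional using (_∈_)
open import Data.Product using (Σ; _×_; _,_)
open import Function.Bundles using (_⇔_)
open import Relation.Binary.PropositionalEquality using (_≡_)

HasCount : {A : Set} → (A → Set) → ℕ → Set
HasCount {A} P m =
  Σ (List A) λ L → Unique L × (∀ x → (x ∈ L) ⇔ P x) × (length L ≡ m)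

pathAdj : (n : ℕ) → Fin n → Fin n → ℕ
pathAdj n i j with suc (toℕ i) ≡ᵇ toℕ j | suc (toℕ j) ≡ᵇ toℕ i
... | true  | _     = 1
... | false | true  = 1
... | false | false = 0

adjMul : (n : ℕ) → Vec ℕ n → Fin n → ℕ
adjMul n r i = V.sum (tabulate λ j → pathAdj n i j * lookup r j)

Positive : {n : ℕ} → Vec ℕ n → Set
Positive {n} v = ∀ (i : Fin n) → 1 ≤ lookup v i

Primitive : {n : ℕ} → Vec ℕ n → Set
Primitive v = foldr gcd 0 (toList v) ≡ 1

IsArithStruct : (n : ℕ) → Vec ℕ n × Vec ℕ n → Set
IsArithStruct n (d , r) =
  Positive d × Positive r × Primitive r ×
  (∀ (i : Fin n) → lookup d i * lookup r i ≡ adjMul n r i)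

-- r(1) = #{ i : r_i = 1 }
ones : {n : ℕ} → Vec ℕ n → ℕ
ones r = length (filter (_≟ 1) (toList r))

-- Ballot numbers: lattice paths of unit E/N steps from (0,0) to (k,ℓ)
-- that never go above y = x.

data Step : Set where
  E N : Step

allSeqs : ℕ → List (List Step)
allSeqs zero    = [] ∷ []
allSeqs (suc m) = concat (map (λ p → (E ∷ p) ∷ (N ∷ p) ∷ []) (allSeqs m))

walkOK : ℕ → ℕ → ℕ → ℕ → List Step → Bool
walkOK k ℓ x y []      = (x ≡ᵇ k) ∧ (y ≡ᵇ ℓ)
walkOK k ℓ x y (E ∷ p) = (y ≤ᵇ suc x) ∧ walkOK k ℓ (suc x) y p
walkOK k ℓ x y (N ∷ p) = (suc y ≤ᵇ x) ∧ walkOK k ℓ x (suc y) p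

isBallotPath : ℕ → ℕ → List Step → Bool
isBallotPath k ℓ p = walkOK k ℓ 0 0 p

countTrue : {A : Set} → (A → Bool) → List A → ℕ
countTrue f []       = 0
countTrue f (x ∷ xs) with f x
... | true  = suc (countTrue f xs)
... | false = countTrue f xs

ballot : ℕ → ℕ → ℕ
ballot k ℓ = countTrue (isBallotPath k ℓ) (allSeqs (k + ℓ))

-- Since d is determined by r, an arithmetical structure on the path is a sequence r of positive
-- integers, starting and ending with 1, in which every entry divides the sum of its neighbours.
-- Between two consecutive 1s such a sequence is obtained from 1, 1 by repeatedly inserting a + b
-- between adjacent entries a and b, and these insertion histories are binary trees. So the
-- structures with k ones correspond to forests of k - 1 binary trees with n - k internal nodes,
-- which obey the same Pascal-type recursion as the ballot numbers. The closed form follows from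
-- the reflection identity B(k, l + 1) + C(k + l + 1, l) = C(k + l + 1, l + 1).
module Submission where

open import Defs
open import Data.Nat using (ℕ; zero; suc; _+_; _*_; _∸_; _≤_; _<_; _≤ᵇ_; _≡ᵇ_; z≤n; s≤s)
open import Data.Nat.Properties
open import Data.Nat.Combinatorics using (_C_; nCk+nC[k+1]≡[n+1]C[k+1]; nC1≡n; nCk≡nC[n∸k])
open import Data.Nat.Tactic.RingSolver using (solve-∀)
open import Data.Nat.Divisibility using (_∣_; divides; 1∣_; ∣m+n∣m⇒∣n; ∣-refl; ∣-trans; _∣0; ∣1⇒≡1)
open import Data.Nat.DivMod using (_/_; m*n/n≡m; m/n*n≡m)
open import Data.Nat.GCD using (gcd; gcd-greatest; gcd-zeroˡ)
open import Algebra.Properties.CommutativeSemigroup +-commutativeSemigroup using (interchange)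
open import Data.Bool using (Bool; true; false; _∧_; T; if_then_else_)
open import Data.Bool.Properties using (T-≡)
open import Data.Fin using (Fin; toℕ; fromℕ<) renaming (zero to fzero; suc to fsuc)
open import Data.Fin.Properties using (toℕ<n; toℕ-fromℕ<)
open import Data.List using (List; []; _∷_; length; map; concat; _++_; filter; replicate; foldr)
open import Data.List.Properties
  using (length-map; length-++; ∷-injective; ∷-injectiveʳ; ++-assoc; ∷ʳ-injective; filter-++; filter-none)
open import Data.List.Membership.Propositional using (_∈_)
open import Data.List.Membership.Propositional.Properties using (∈-map⁺; ∈-map⁻; ∈-++⁺ˡ; ∈-++⁺ʳ)
open import Data.List.Relation.Unary.Any using (here)
open import Data.List.Relation.Unary.All as All using (All; []; _∷_)
import Data.List.Relation.Unary.All.Properties as Allₚ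
open import Data.List.Relation.Unary.AllPairs using ([]; _∷_)
open import Data.List.Relation.Unary.Linked using (Linked; []; [-]; _∷_)
open import Data.List.Relation.Unary.Unique.Propositional using (Unique)
import Data.List.Relation.Unary.Unique.Propositional.Properties as Unique
open import Data.Vec using (Vec; []; _∷_; lookup; tabulate; toList)
import Data.Vec as V
import Data.Vec.Properties as V
open import Data.Product using (_×_; _,_; proj₁; proj₂; ∃)
open import Data.Sum using (_⊎_; inj₁; inj₂)
open import Data.Unit using (⊤; tt)
open import Data.Empty using (⊥; ⊥-elim)
open import Function.Base using (_∘_)
open import Function.Bundles using (_⇔_; mk⇔; Equivalence)
open import Relation.Nullary using (¬_; contradiction; yes; no)
open import Relation.Binary.PropositionalEquality

Unique-map⁺-on : {A B : Set} {P : A → Set} {f : A → B} →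
  (∀ {x y} → P x → P y → f x ≡ f y → x ≡ y) →
  ∀ {xs} → All P xs → Unique xs → Unique (map f xs)
Unique-map⁺-on inj [] [] = []
Unique-map⁺-on {P = P} {f} inj (px ∷ pxs) (x∉xs ∷ uxs) =
  Allₚ.map⁺ (images-distinct x∉xs pxs) ∷ Unique-map⁺-on inj pxs uxs
  where
  images-distinct : ∀ {ys} → All (_ ≢_) ys → All P ys → All (λ y → f _ ≢ f y) ys
  images-distinct [] [] = []
  images-distinct (x≢y ∷ x≢ys) (py ∷ pys) = (λ eq → x≢y (inj px py eq)) ∷ images-distinct x≢ys pys

HasCount-map : {A B : Set} {P : A → Set} {Q : B → Set} {m : ℕ} (f : A → B) →
  (∀ x → P x → Q (f x)) →
  (∀ {x y} → P x → P y → f x ≡ f y → x ≡ y) →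
  (∀ {y} → Q y → ∃ λ x → P x × f x ≡ y) →
  HasCount P m → HasCount Q m
HasCount-map {P = P} {Q} f preserves injective surjective (xs , unique , members , length≡) =
  map f xs , Unique-map⁺-on injective (All.tabulate (Equivalence.to (members _))) unique ,
  (λ y → mk⇔ (sound y) (complete y)) , trans (length-map f xs) length≡
  where
  sound : ∀ y → y ∈ map f xs → Q y
  sound y y∈ with ∈-map⁻ f y∈
  ... | x , x∈xs , refl = preserves x (Equivalence.to (members x) x∈xs)
  complete : ∀ y → Q y → y ∈ map f xs
  complete y qy with surjective qy
  ... | x , px , refl = ∈-map⁺ f (Equivalence.from (members x) px)

-- Ballot numbers

indicator : Bool → ℕ
indicator true  = 1
indicator false = 0

indicator-∧-false : ∀ a b → (T a → T b → ⊥) → indicator (a ∧ b) ≡ 0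
indicator-∧-false true  true  contra = ⊥-elim (contra tt tt)
indicator-∧-false true  false contra = refl
indicator-∧-false false b     contra = refl

≤ᵇ-true : ∀ {m n} → m ≤ n → (m ≤ᵇ n) ≡ true
≤ᵇ-true m≤n = Equivalence.to T-≡ (≤⇒≤ᵇ m≤n)

≤ᵇ-false : ∀ {m n} → ¬ m ≤ n → (m ≤ᵇ n) ≡ false
≤ᵇ-false {m} {n} m≰n with m ≤ᵇ n | ≤ᵇ⇒≤ m n
... | true  | sound = contradiction (sound tt) m≰n
... | false | _     = refl

countTrue-false : {A : Set} (xs : List A) → countTrue (λ _ → false) xs ≡ 0
countTrue-false []       = refl
countTrue-false (x ∷ xs) = countTrue-false xs

countTrue-guard : {A : Set} (b : Bool) (f : A → Bool) (xs : List A) →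
  countTrue (λ x → b ∧ f x) xs ≡ (if b then countTrue f xs else 0)
countTrue-guard true  f xs = refl
countTrue-guard false f xs = countTrue-false xs

countTrue-∷ : {A : Set} (f : A → Bool) (x : A) (xs : List A) →
  countTrue f (x ∷ xs) ≡ indicator (f x) + countTrue f xs
countTrue-∷ f x xs with f x
... | true  = refl
... | false = refl

countTrue-branch : (f : List Step → Bool) (ps : List (List Step)) →
  countTrue f (concat (map (λ p → (E ∷ p) ∷ (N ∷ p) ∷ []) ps))
    ≡ countTrue (λ p → f (E ∷ p)) ps + countTrue (λ p → f (N ∷ p)) ps
countTrue-branch f [] = refl
countTrue-branch f (p ∷ ps) = begin
  countTrue f ((E ∷ p) ∷ (N ∷ p) ∷ rest)      ≡⟨ countTrue-∷ f (E ∷ p) _ ⟩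
  iE + countTrue f ((N ∷ p) ∷ rest)            ≡⟨ cong (iE +_) (countTrue-∷ f (N ∷ p) rest) ⟩
  iE + (iN + countTrue f rest)                 ≡⟨ cong (λ c → iE + (iN + c)) (countTrue-branch f ps) ⟩
  iE + (iN + (countTrue fE ps + countTrue fN ps)) ≡⟨ sym (+-assoc iE iN _) ⟩
  (iE + iN) + (countTrue fE ps + countTrue fN ps) ≡⟨ interchange iE iN _ _ ⟩
  (iE + countTrue fE ps) + (iN + countTrue fN ps)
    ≡⟨ sym (cong₂ _+_ (countTrue-∷ fE p ps) (countTrue-∷ fN p ps)) ⟩
  countTrue fE (p ∷ ps) + countTrue fN (p ∷ ps) ∎
  where
  open ≡-Reasoning
  rest = concat (map (λ p → (E ∷ p) ∷ (N ∷ p) ∷ []) ps)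
  fE fN : List Step → Bool
  fE q = f (E ∷ q)
  fN q = f (N ∷ q)
  iE = indicator (f (E ∷ p))
  iN = indicator (f (N ∷ p))

walks : ℕ → ℕ → ℕ → ℕ → ℕ → ℕ
walks k ℓ x y m = countTrue (walkOK k ℓ x y) (allSeqs m)

walks-suc : ∀ k ℓ x y m → walks k ℓ x y (suc m) ≡
  (if y ≤ᵇ suc x then walks k ℓ (suc x) y m else 0) + (if suc y ≤ᵇ x then walks k ℓ x (suc y) m else 0)
walks-suc k ℓ x y m = trans (countTrue-branch (walkOK k ℓ x y) (allSeqs m))
  (cong₂ _+_ (countTrue-guard (y ≤ᵇ suc x) _ (allSeqs m)) (countTrue-guard (suc y ≤ᵇ x) _ (allSeqs m)))

walks-below : ∀ {k ℓ x y} m → y < x →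
  walks k ℓ x y (suc m) ≡ walks k ℓ (suc x) y m + walks k ℓ x (suc y) m
walks-below {k} {ℓ} {x} {y} m y<x = trans (walks-suc k ℓ x y m)
  (cong₂ _+_ (cong (λ b → if b then walks k ℓ (suc x) y m else 0) (≤ᵇ-true (m≤n⇒m≤1+n (<⇒≤ y<x))))
             (cong (λ b → if b then walks k ℓ x (suc y) m else 0) (≤ᵇ-true y<x)))

walks-diagonal : ∀ {k ℓ} x m → walks k ℓ x x (suc m) ≡ walks k ℓ (suc x) x m
walks-diagonal {k} {ℓ} x m = trans (walks-suc k ℓ x x m)
  (trans (cong₂ _+_ (cong (λ b → if b then walks k ℓ (suc x) x m else 0) (≤ᵇ-true (n≤1+n x)))
                    (cong (λ b → if b then walks k ℓ x (suc x) m else 0) (≤ᵇ-false (n≮n x))))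
         (+-identityʳ _))

walks-zero : ∀ k ℓ x y → walks k ℓ x y 0 ≡ indicator ((x ≡ᵇ k) ∧ (y ≡ᵇ ℓ))
walks-zero k ℓ x y with (x ≡ᵇ k) ∧ (y ≡ᵇ ℓ)
... | true  = refl
... | false = refl

walks-zero-shiftˣ : ∀ k ℓ x y → walks (suc k) ℓ (suc x) y 0 ≡ walks k ℓ x y 0
walks-zero-shiftˣ k ℓ x y = trans (walks-zero (suc k) ℓ (suc x) y) (sym (walks-zero k ℓ x y))

walks-zero-shiftʸ : ∀ k ℓ x y → walks k (suc ℓ) x (suc y) 0 ≡ walks k ℓ x y 0
walks-zero-shiftʸ k ℓ x y = trans (walks-zero k (suc ℓ) x (suc y)) (sym (walks-zero k ℓ x y))

walks-zero-elsewhere : ∀ {k ℓ x y} → (x ≡ k → y ≢ ℓ) → walks k ℓ x y 0 ≡ 0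
walks-zero-elsewhere {k} {ℓ} {x} {y} off = trans (walks-zero k ℓ x y)
  (indicator-∧-false (x ≡ᵇ k) (y ≡ᵇ ℓ) (λ p q → off (≡ᵇ⇒≡ x k p) (≡ᵇ⇒≡ y ℓ q)))

walks-unreachable : ∀ {k ℓ} → k < ℓ → ∀ m x y → y ≤ x → walks k ℓ x y m ≡ 0
walks-unreachable k<ℓ zero x y y≤x =
  walks-zero-elsewhere (λ x≡k y≡ℓ → <⇒≱ k<ℓ (subst₂ _≤_ y≡ℓ x≡k y≤x))
walks-unreachable k<ℓ (suc m) x y y≤x with m≤n⇒m<n∨m≡n y≤x
... | inj₁ y<x = trans (walks-below m y<x)
  (cong₂ _+_ (walks-unreachable k<ℓ m (suc x) y (m≤n⇒m≤1+n y≤x)) (walks-unreachable k<ℓ m x (suc y) y<x))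
... | inj₂ refl = trans (walks-diagonal x m) (walks-unreachable k<ℓ m (suc x) x (n≤1+n x))

walks-last-north : ∀ {k ℓ} → ℓ ≤ k → ∀ m x y → y ≤ x →
  walks (suc k) (suc ℓ) x y (suc m) ≡ walks k (suc ℓ) x y m + walks (suc k) ℓ x y m
walks-last-north {k} {ℓ} ℓ≤k zero x y y≤x with m≤n⇒m<n∨m≡n y≤x
... | inj₁ y<x = trans (walks-below 0 y<x)
  (cong₂ _+_ (walks-zero-shiftˣ k (suc ℓ) x y) (walks-zero-shiftʸ (suc k) ℓ x y))
... | inj₂ refl = trans (walks-diagonal x 0) (trans (walks-zero-shiftˣ k (suc ℓ) x x)
  (sym (trans (cong (walks k (suc ℓ) x x 0 +_) (walks-zero-elsewhere unreachable)) (+-identityʳ _))))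
  where
  unreachable : x ≡ suc k → x ≢ ℓ
  unreachable refl x≡ℓ = 1+n≰n (subst (_≤ k) (sym x≡ℓ) ℓ≤k)
walks-last-north {k} {ℓ} ℓ≤k (suc m) x y y≤x with m≤n⇒m<n∨m≡n y≤x
... | inj₁ y<x = begin
  walks K L x y (suc (suc m))                                 ≡⟨ walks-below (suc m) y<x ⟩
  walks K L (suc x) y (suc m) + walks K L x (suc y) (suc m)
    ≡⟨ cong₂ _+_ (walks-last-north ℓ≤k m (suc x) y (m≤n⇒m≤1+n y≤x)) (walks-last-north ℓ≤k m x (suc y) y<x) ⟩
  (walks k L (suc x) y m + walks K ℓ (suc x) y m) + (walks k L x (suc y) m + walks K ℓ x (suc y) m)
    ≡⟨ interchange (walks k L (suc x) y m) _ _ _ ⟩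
  (walks k L (suc x) y m + walks k L x (suc y) m) + (walks K ℓ (suc x) y m + walks K ℓ x (suc y) m)
    ≡⟨ sym (cong₂ _+_ (walks-below m y<x) (walks-below m y<x)) ⟩
  walks k L x y (suc m) + walks K ℓ x y (suc m)                ∎
  where
  open ≡-Reasoning
  K = suc k
  L = suc ℓ
... | inj₂ refl = trans (walks-diagonal x (suc m)) (trans (walks-last-north ℓ≤k m (suc x) x (n≤1+n x))
  (sym (cong₂ _+_ (walks-diagonal x m) (walks-diagonal x m))))

walks-last-east : ∀ {k} m x y → y ≤ x → walks (suc k) 0 x y (suc m) ≡ walks k 0 x y m
walks-last-east {k} zero x y y≤x with m≤n⇒m<n∨m≡n y≤x
... | inj₁ y<x = trans (walks-below 0 y<x) (trans
  (cong₂ _+_ (walks-zero-shiftˣ k 0 x y) (walks-zero-elsewhere {suc k} {0} {x} {suc y} (λ _ ()))) (+-identityʳ _))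
... | inj₂ refl = trans (walks-diagonal x 0) (walks-zero-shiftˣ k 0 x x)
walks-last-east {k} (suc m) x y y≤x with m≤n⇒m<n∨m≡n y≤x
... | inj₁ y<x = trans (walks-below (suc m) y<x) (trans
  (cong₂ _+_ (walks-last-east m (suc x) y (m≤n⇒m≤1+n y≤x)) (walks-last-east m x (suc y) y<x))
  (sym (walks-below m y<x)))
... | inj₂ refl = trans (walks-diagonal x (suc m))
  (trans (walks-last-east m (suc x) x (n≤1+n x)) (sym (walks-diagonal x m)))

ballot-pascal : ∀ {k ℓ} → ℓ ≤ k → ballot (suc k) (suc ℓ) ≡ ballot k (suc ℓ) + ballot (suc k) ℓ
ballot-pascal {k} {ℓ} ℓ≤k = trans (walks-last-north ℓ≤k (k + suc ℓ) 0 0 z≤n)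
  (cong (λ m → ballot k (suc ℓ) + walks (suc k) ℓ 0 0 m) (+-suc k ℓ))

ballot-zero : ∀ k → ballot k 0 ≡ 1
ballot-zero zero    = refl
ballot-zero (suc k) = trans (walks-last-east (k + 0) 0 0 z≤n) (ballot-zero k)

ballot-above : ∀ {k ℓ} → k < ℓ → ballot k ℓ ≡ 0
ballot-above {k} {ℓ} k<ℓ = walks-unreachable k<ℓ (k + ℓ) 0 0 z≤n

-- Closed form

ballot-reflection : ∀ {k ℓ} → ℓ ≤ k → ballot k (suc ℓ) + (k + suc ℓ) C ℓ ≡ (k + suc ℓ) C suc ℓ
ballot-reflection {k} {ℓ} ℓ≤k with m≤n⇒m<n∨m≡n ℓ≤k
... | inj₂ refl = trans (cong (_+ (ℓ + suc ℓ) C ℓ) (ballot-above (n<1+n ℓ)))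
  (trans (nCk≡nC[n∸k] (m≤m+n ℓ (suc ℓ))) (cong ((ℓ + suc ℓ) C_) (m+n∸m≡n ℓ (suc ℓ))))
ballot-reflection {suc k} {zero} _ | inj₁ _ = begin
  ballot (suc k) 1 + 1                 ≡⟨ cong (_+ 1) (ballot-pascal {k} z≤n) ⟩
  (ballot k 1 + ballot (suc k) 0) + 1  ≡⟨ cong (λ b → (ballot k 1 + b) + 1) (ballot-zero (suc k)) ⟩
  (ballot k 1 + 1) + 1                 ≡⟨ cong (_+ 1) (ballot-reflection {k} z≤n) ⟩
  (k + 1) C 1 + 1                      ≡⟨ cong (_+ 1) (nC1≡n (k + 1)) ⟩
  (k + 1) + 1                          ≡⟨ +-comm (k + 1) 1 ⟩
  suc (k + 1)                          ≡⟨ sym (nC1≡n (suc (k + 1))) ⟩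
  suc (k + 1) C 1                      ∎
  where open ≡-Reasoning
ballot-reflection {suc k} {suc ℓ} _ | inj₁ (s≤s L≤k) = begin
  ballot (suc k) (suc L) + suc M C L
    ≡⟨ cong₂ _+_ (ballot-pascal L≤k) (sym (nCk+nC[k+1]≡[n+1]C[k+1] M ℓ)) ⟩
  (ballot k (suc L) + ballot (suc k) L) + (M C ℓ + M C L)
    ≡⟨ cong (ballot k (suc L) + ballot (suc k) L +_) (+-comm (M C ℓ) (M C L)) ⟩
  (ballot k (suc L) + ballot (suc k) L) + (M C L + M C ℓ)
    ≡⟨ interchange (ballot k (suc L)) _ _ _ ⟩
  (ballot k (suc L) + M C L) + (ballot (suc k) L + M C ℓ)
    ≡⟨ cong₂ _+_ (ballot-reflection L≤k) shifted ⟩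
  M C suc L + M C L
    ≡⟨ +-comm (M C suc L) (M C L) ⟩
  M C L + M C suc L
    ≡⟨ nCk+nC[k+1]≡[n+1]C[k+1] M L ⟩
  suc M C suc L
    ∎
  where
  open ≡-Reasoning
  L = suc ℓ
  M = k + suc L
  shifted : ballot (suc k) L + M C ℓ ≡ M C L
  shifted = subst (λ m → ballot (suc k) L + m C ℓ ≡ m C L) (sym (+-suc k L))
                  (ballot-reflection {suc k} {ℓ} (m≤n⇒m≤1+n (<⇒≤ L≤k)))

[1+k]*[1+n]C[1+k]≡[1+n]*nCk : ∀ n k → suc k * (suc n C suc k) ≡ suc n * (n C k)
[1+k]*[1+n]C[1+k]≡[1+n]*nCk zero    zero    = refl
[1+k]*[1+n]C[1+k]≡[1+n]*nCk zero    (suc k) = *-zeroʳ (suc (suc k))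
[1+k]*[1+n]C[1+k]≡[1+n]*nCk (suc n) zero    =
  trans (*-identityˡ _) (trans (nC1≡n (suc (suc n))) (sym (*-identityʳ (suc (suc n)))))
[1+k]*[1+n]C[1+k]≡[1+n]*nCk (suc n) (suc k) = begin
  suc K * (suc n′ C suc K)                          ≡⟨ cong (suc K *_) (sym (nCk+nC[k+1]≡[n+1]C[k+1] n′ K)) ⟩
  suc K * (n′ C K + n′ C suc K)                      ≡⟨ *-distribˡ-+ (suc K) (n′ C K) (n′ C suc K) ⟩
  (n′ C K + K * (n′ C K)) + suc K * (n′ C suc K)
    ≡⟨ cong₂ (λ a b → (n′ C K + a) + b) ([1+k]*[1+n]C[1+k]≡[1+n]*nCk n k) ([1+k]*[1+n]C[1+k]≡[1+n]*nCk n K) ⟩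
  (n′ C K + n′ * (n C k)) + n′ * (n C K)              ≡⟨ +-assoc (n′ C K) _ _ ⟩
  n′ C K + (n′ * (n C k) + n′ * (n C K))              ≡⟨ cong (n′ C K +_) (sym (*-distribˡ-+ n′ (n C k) (n C K))) ⟩
  n′ C K + n′ * (n C k + n C K)                      ≡⟨ cong (λ c → n′ C K + n′ * c) (nCk+nC[k+1]≡[n+1]C[k+1] n k) ⟩
  suc n′ * (n′ C K)                                  ∎
  where
  open ≡-Reasoning
  n′ = suc n
  K = suc k

[1+j]*[1+a+j]C[1+j]≡[1+a]*[1+a+j]Cj : ∀ a j → suc j * ((suc a + j) C suc j) ≡ suc a * ((suc a + j) C j)
[1+j]*[1+a+j]C[1+j]≡[1+a]*[1+a+j]Cj a zero =
  trans (*-identityˡ _) (trans (nC1≡n (suc a + 0)) (trans (+-identityʳ (suc a)) (sym (*-identityʳ (suc a)))))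
[1+j]*[1+a+j]C[1+j]≡[1+a]*[1+a+j]Cj a (suc j) = +-cancelˡ-≡ (suc j * X) _ _ (begin
  suc j * X + suc (suc j) * (suc n C suc (suc j))
    ≡⟨ cong₂ _+_ ([1+k]*[1+n]C[1+k]≡[1+n]*nCk n j) ([1+k]*[1+n]C[1+k]≡[1+n]*nCk n (suc j)) ⟩
  suc n * (n C j) + suc n * (n C suc j)   ≡⟨ sym (*-distribˡ-+ (suc n) (n C j) (n C suc j)) ⟩
  suc n * (n C j + n C suc j)             ≡⟨ cong (suc n *_) (nCk+nC[k+1]≡[n+1]C[k+1] n j) ⟩
  suc n * X                               ≡⟨ cong (_* X) (+-comm (suc a) (suc j)) ⟩
  (suc j + suc a) * X                     ≡⟨ *-distribʳ-+ X (suc j) (suc a) ⟩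
  suc j * X + suc a * X                   ∎)
  where
  open ≡-Reasoning
  n = a + suc j
  X = suc n C suc j

ballot-closed-form : ∀ k ℓ → suc (k + ℓ) * ballot (k + ℓ) ℓ ≡ suc k * ((k + ℓ + ℓ) C ℓ)
ballot-closed-form k zero = trans (cong (suc (k + 0) *_) (ballot-zero (k + 0)))
  (cong (λ m → suc m * 1) (+-identityʳ k))
ballot-closed-form k (suc ℓ) = +-cancelʳ-≡ (suc ℓ * X) _ _ (begin
  suc K * ballot K (suc ℓ) + suc ℓ * X
    ≡⟨ cong (suc K * ballot K (suc ℓ) +_) absorbed ⟩
  suc K * ballot K (suc ℓ) + suc K * (M C ℓ) ≡⟨ sym (*-distribˡ-+ (suc K) (ballot K (suc ℓ)) (M C ℓ)) ⟩
  suc K * (ballot K (suc ℓ) + M C ℓ)        ≡⟨ cong (suc K *_) (ballot-reflection (≤-trans (n≤1+n ℓ) (m≤n+m (suc ℓ) k))) ⟩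
  suc K * X                                 ≡⟨ *-distribʳ-+ X (suc k) (suc ℓ) ⟩
  suc k * X + suc ℓ * X                     ∎)
  where
  open ≡-Reasoning
  K = k + suc ℓ
  M = K + suc ℓ
  X = M C suc ℓ
  absorbed : suc ℓ * X ≡ suc K * (M C ℓ)
  absorbed = subst (λ m → suc ℓ * (m C suc ℓ) ≡ suc K * (m C ℓ)) (sym (+-suc K ℓ))
                   ([1+j]*[1+a+j]C[1+j]≡[1+a]*[1+a+j]Cj K ℓ)

ballot-formula : ∀ {n k} → k ≤ n → (n ∸ 1) * ballot (n ∸ 2) (n ∸ k) ≡ (k ∸ 1) * ((2 * n ∸ 2 ∸ k) C (n ∸ 2))
ballot-formula {zero}        {zero}        _ = refl
ballot-formula {suc n}       {zero}        _ =
  trans (cong (n *_) (ballot-above (s≤s (m∸n≤m n 1)))) (*-zeroʳ n)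
ballot-formula {suc zero}    {suc zero}    _ = refl
ballot-formula {suc zero}    {suc (suc _)} (s≤s ())
ballot-formula {suc (suc n)} {suc zero}    _ =
  trans (cong (suc n *_) (ballot-above (n<1+n n))) (*-zeroʳ (suc n))
ballot-formula {suc (suc n)} {suc (suc k)} (s≤s (s≤s k≤n)) with m≤n⇒∃[o]m+o≡n k≤n
... | ℓ , refl = begin
  suc (k + ℓ) * ballot (k + ℓ) (k + ℓ ∸ k)    ≡⟨ cong (λ m → suc (k + ℓ) * ballot (k + ℓ) m) (m+n∸m≡n k ℓ) ⟩
  suc (k + ℓ) * ballot (k + ℓ) ℓ              ≡⟨ ballot-closed-form k ℓ ⟩
  suc k * ((k + ℓ + ℓ) C ℓ)                  ≡⟨ cong (suc k *_) (sym symmetric) ⟩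
  suc k * ((k + ℓ + ℓ) C (k + ℓ))            ≡⟨ cong (λ m → suc k * (m C (k + ℓ))) (sym top) ⟩
  suc k * ((2 * (2 + (k + ℓ)) ∸ 2 ∸ (2 + k)) C (k + ℓ)) ∎
  where
  open ≡-Reasoning
  symmetric : (k + ℓ + ℓ) C (k + ℓ) ≡ (k + ℓ + ℓ) C ℓ
  symmetric = trans (nCk≡nC[n∸k] (m≤m+n (k + ℓ) ℓ)) (cong ((k + ℓ + ℓ) C_) (m+n∸m≡n (k + ℓ) ℓ))
  twice : ∀ k ℓ → 2 * (2 + (k + ℓ)) ≡ 2 + ((2 + k) + (k + ℓ + ℓ))
  twice = solve-∀
  top : 2 * (2 + (k + ℓ)) ∸ 2 ∸ (2 + k) ≡ k + ℓ + ℓ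
  top = trans (cong (λ m → m ∸ 2 ∸ (2 + k)) (twice k ℓ)) (m+n∸m≡n (2 + k) (k + ℓ + ℓ))

-- Binary forests

data Tree : Set where
  leaf : Tree
  node : Tree → Tree → Tree

size : Tree → ℕ
size leaf       = 0
size (node l r) = suc (size l + size r)

forestSize : List Tree → ℕ
forestSize []      = 0
forestSize (t ∷ f) = size t + forestSize f

ForestOf : ℕ → ℕ → List Tree → Set
ForestOf t q f = length f ≡ t × forestSize f ≡ q

joinFirst : List Tree → List Tree
joinFirst (a ∷ b ∷ f) = node a b ∷ f
joinFirst f           = f

forests : ℕ → ℕ → List (List Tree)
forests zero    zero    = [] ∷ []
forests zero    (suc q) = []
forests (suc t) zero    = map (leaf ∷_) (forests t zero)
forests (suc t) (suc q) = map (leaf ∷_) (forests t (suc q)) ++ map joinFirst (forests (suc (suc t)) q)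

forestSize-joinFirst : ∀ a b f → forestSize (joinFirst (a ∷ b ∷ f)) ≡ suc (forestSize (a ∷ b ∷ f))
forestSize-joinFirst a b f = cong suc (+-assoc (size a) (size b) (forestSize f))

joinFirst-ForestOf : ∀ {t q} f → ForestOf (suc (suc t)) q f → ForestOf (suc t) (suc q) (joinFirst f)
joinFirst-ForestOf (a ∷ b ∷ f) (refl , refl) = refl , forestSize-joinFirst a b f

joinFirst-injective : ∀ {t} {f g} → length f ≡ suc (suc t) → length g ≡ suc (suc t) →
  joinFirst f ≡ joinFirst g → f ≡ g
joinFirst-injective {f = a ∷ b ∷ f} {c ∷ d ∷ g} _ _ eq with ∷-injective eq
... | refl , refl = refl

leaf∷≢joinFirst : ∀ {t} g f → length f ≡ suc (suc t) → leaf ∷ g ≢ joinFirst f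
leaf∷≢joinFirst g (a ∷ b ∷ f) _ ()

forests-complete : ∀ t q f → ForestOf t q f → f ∈ forests t q
forests-complete zero    zero    []           (refl , refl) = here refl
forests-complete (suc t) zero    (leaf ∷ f)   (len , sz)    =
  ∈-map⁺ (leaf ∷_) (forests-complete t zero f (suc-injective len , sz))
forests-complete (suc t) (suc q) (leaf ∷ f)   (len , sz)    =
  ∈-++⁺ˡ (∈-map⁺ (leaf ∷_) (forests-complete t (suc q) f (suc-injective len , sz)))
forests-complete (suc t) zero    (node a b ∷ f) (_ , sz)
  with () ← trans (sym (forestSize-joinFirst a b f)) sz
forests-complete (suc t) (suc q) (node a b ∷ f) (len , sz) =
  ∈-++⁺ʳ (map (leaf ∷_) (forests t (suc q))) (∈-map⁺ joinFirst
    (forests-complete (suc (suc t)) q (a ∷ b ∷ f) (cong suc len , suc-injective (trans (sym (forestSize-joinFirst a b f)) sz))))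

forests-sound : ∀ t q → All (ForestOf t q) (forests t q)
forests-sound zero    zero    = (refl , refl) ∷ []
forests-sound zero    (suc q) = []
forests-sound (suc t) zero    = Allₚ.map⁺ (All.map (λ (len , sz) → cong suc len , sz) (forests-sound t zero))
forests-sound (suc t) (suc q) = Allₚ.++⁺
  (Allₚ.map⁺ (All.map (λ (len , sz) → cong suc len , sz) (forests-sound t (suc q))))
  (Allₚ.map⁺ (All.map (λ {f} → joinFirst-ForestOf f) (forests-sound (suc (suc t)) q)))

forests-unique : ∀ t q → Unique (forests t q)
forests-unique zero    zero    = [] ∷ []
forests-unique zero    (suc q) = []
forests-unique (suc t) zero    = Unique.map⁺ ∷-injectiveʳ (forests-unique t zero)
forests-unique (suc t) (suc q) = Unique.++⁺
  (Unique.map⁺ ∷-injectiveʳ (forests-unique t (suc q)))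
  (Unique-map⁺-on (λ p q → joinFirst-injective (proj₁ p) (proj₁ q)) (forests-sound (suc (suc t)) q)
    (forests-unique (suc (suc t)) q))
  disjoint
  where
  disjoint : ∀ {f} → ¬ (f ∈ map (leaf ∷_) (forests t (suc q)) × f ∈ map joinFirst (forests (suc (suc t)) q))
  disjoint (f∈ˡ , f∈ʳ) with ∈-map⁻ (leaf ∷_) f∈ˡ | ∈-map⁻ joinFirst f∈ʳ
  ... | g , _ , refl | h , h∈ , eq =
    leaf∷≢joinFirst g h (proj₁ (All.lookup (forests-sound (suc (suc t)) q) h∈)) eq

forests-HasCount : ∀ t q → HasCount (ForestOf t q) (length (forests t q))
forests-HasCount t q = forests t q , forests-unique t q ,
  (λ f → mk⇔ (All.lookup (forests-sound t q)) (forests-complete t q f)) , refl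

length-forests : ∀ t q → length (forests t q) ≡ ballot (t + q ∸ 1) q
length-forests zero    zero    = refl
length-forests zero    (suc q) = sym (ballot-above (n<1+n q))
length-forests (suc t) zero    =
  trans (length-map (leaf ∷_) (forests t zero))
        (trans (length-forests t zero) (trans (ballot-zero (t + 0 ∸ 1)) (sym (ballot-zero (t + 0)))))
length-forests (suc t) (suc q) = begin
  length (map (leaf ∷_) (forests t (suc q)) ++ map joinFirst (forests (suc (suc t)) q))
    ≡⟨ length-++ (map (leaf ∷_) (forests t (suc q))) ⟩
  length (map (leaf ∷_) (forests t (suc q))) + length (map joinFirst (forests (suc (suc t)) q))
    ≡⟨ cong₂ _+_ (length-map (leaf ∷_) (forests t (suc q))) (length-map joinFirst (forests (suc (suc t)) q)) ⟩
  length (forests t (suc q)) + length (forests (suc (suc t)) q)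
    ≡⟨ cong₂ _+_ (length-forests t (suc q)) (length-forests (suc (suc t)) q) ⟩
  ballot (t + suc q ∸ 1) (suc q) + ballot (suc (t + q)) q
    ≡⟨ cong (λ m → ballot (m ∸ 1) (suc q) + ballot (suc (t + q)) q) (+-suc t q) ⟩
  ballot (t + q) (suc q) + ballot (suc (t + q)) q
    ≡⟨ sym (ballot-pascal (m≤n+m q t)) ⟩
  ballot (suc (t + q)) (suc q)
    ≡⟨ cong (λ m → ballot m (suc q)) (sym (+-suc t q)) ⟩
  ballot (t + suc q) (suc q)
    ∎
  where open ≡-Reasoning

-- Forest sequences

between : ℕ → ℕ → Tree → List ℕ
between a b leaf       = []
between a b (node l r) = between a (a + b) l ++ (a + b) ∷ between (a + b) b r

treesSeq : List Tree → List ℕ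
treesSeq []      = []
treesSeq (t ∷ f) = between 1 1 t ++ 1 ∷ treesSeq f

forestSeq : List Tree → List ℕ
forestSeq f = 1 ∷ treesSeq f

countOnes : List ℕ → ℕ
countOnes l = length (filter (_≟ 1) l)

length-between : ∀ a b t → length (between a b t) ≡ size t
length-between a b leaf       = refl
length-between a b (node l r) = begin
  length (between a (a + b) l ++ (a + b) ∷ between (a + b) b r)
    ≡⟨ length-++ (between a (a + b) l) ⟩
  length (between a (a + b) l) + suc (length (between (a + b) b r))
    ≡⟨ cong₂ (λ m n → m + suc n) (length-between a (a + b) l) (length-between (a + b) b r) ⟩
  size l + suc (size r)
    ≡⟨ +-suc (size l) (size r) ⟩
  suc (size l + size r) ∎
  where open ≡-Reasoning

length-forestSeq : ∀ f → length (forestSeq f) ≡ suc (length f + forestSize f)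
length-forestSeq []      = refl
length-forestSeq (t ∷ f) = begin
  suc (length (between 1 1 t ++ 1 ∷ treesSeq f))  ≡⟨ cong suc (length-++ (between 1 1 t)) ⟩
  suc (length (between 1 1 t) + length (forestSeq f))
    ≡⟨ cong₂ (λ m n → suc (m + n)) (length-between 1 1 t) (length-forestSeq f) ⟩
  suc (size t + suc (length f + forestSize f))    ≡⟨ cong suc (+-suc (size t) _) ⟩
  suc (suc (size t + (length f + forestSize f)))  ≡⟨ cong (suc ∘ suc) (swap (size t) (length f) _) ⟩
  suc (suc (length f + (size t + forestSize f)))  ∎
  where
  open ≡-Reasoning
  swap : ∀ a b c → a + (b + c) ≡ b + (a + c)
  swap = solve-∀

between-≥ : ∀ a b t → All (a + b ≤_) (between a b t)
between-≥ a b leaf       = []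
between-≥ a b (node l r) = Allₚ.++⁺
  (All.map (≤-trans (m≤n+m (a + b) a)) (between-≥ a (a + b) l))
  (≤-refl ∷ All.map (≤-trans (m≤m+n (a + b) b)) (between-≥ (a + b) b r))

++-∷-cancel : ∀ {m : ℕ} xs ys xs′ ys′ → All (_≢ m) xs → All (_≢ m) xs′ →
  xs ++ m ∷ ys ≡ xs′ ++ m ∷ ys′ → xs ≡ xs′ × ys ≡ ys′
++-∷-cancel []       ys []         ys′ _          _          eq = refl , ∷-injectiveʳ eq
++-∷-cancel []       ys (x′ ∷ xs′) ys′ _          (x′≢m ∷ _) eq = ⊥-elim (x′≢m (sym (proj₁ (∷-injective eq))))
++-∷-cancel (x ∷ xs) ys []         ys′ (x≢m ∷ _)  _          eq = ⊥-elim (x≢m (proj₁ (∷-injective eq)))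
++-∷-cancel (x ∷ xs) ys (x′ ∷ xs′) ys′ (_ ∷ xs≢m) (_ ∷ xs′≢m) eq with ∷-injective eq
... | refl , eq′ with ++-∷-cancel xs ys xs′ ys′ xs≢m xs′≢m eq′
... | refl , refl = refl , refl

++-∷≢[] : ∀ (xs : List ℕ) y ys → xs ++ y ∷ ys ≢ []
++-∷≢[] []       y ys ()
++-∷≢[] (x ∷ xs) y ys ()

all-≢ : ∀ {c} {xs : List ℕ} → All (suc c ≤_) xs → All (_≢ c) xs
all-≢ = All.map (λ c<x x≡c → <-irrefl (sym x≡c) c<x)

between-injective : ∀ {a b} → 1 ≤ a → 1 ≤ b → ∀ t t′ → between a b t ≡ between a b t′ → t ≡ t′
between-injective _   _   leaf       leaf         _  = refl
between-injective _   _   leaf       (node l′ r′) eq = ⊥-elim (++-∷≢[] (between _ _ l′) _ _ (sym eq))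
between-injective _   _   (node l r) leaf         eq = ⊥-elim (++-∷≢[] (between _ _ l) _ _ eq)
between-injective {a} {b} 1≤a 1≤b (node l r) (node l′ r′) eq =
  cong₂ node (between-injective 1≤a 1≤a+b l l′ (proj₁ halves)) (between-injective 1≤a+b 1≤b r r′ (proj₂ halves))
  where
  1≤a+b : 1 ≤ a + b
  1≤a+b = ≤-trans 1≤a (m≤m+n a b)
  left-≢ : ∀ t → All (_≢ a + b) (between a (a + b) t)
  left-≢ t = all-≢ (All.map (≤-trans (+-monoˡ-≤ (a + b) 1≤a)) (between-≥ a (a + b) t))
  halves = ++-∷-cancel (between a (a + b) l) _ (between a (a + b) l′) _ (left-≢ l) (left-≢ l′) eq

treesSeq-injective : ∀ f g → treesSeq f ≡ treesSeq g → f ≡ g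
treesSeq-injective []      []      _  = refl
treesSeq-injective []      (t ∷ g) eq = ⊥-elim (++-∷≢[] (between 1 1 t) _ _ (sym eq))
treesSeq-injective (t ∷ f) []      eq = ⊥-elim (++-∷≢[] (between 1 1 t) _ _ eq)
treesSeq-injective (t ∷ f) (u ∷ g) eq
  with ++-∷-cancel (between 1 1 t) _ (between 1 1 u) _ (all-≢ (between-≥ 1 1 t)) (all-≢ (between-≥ 1 1 u)) eq
... | eq₁ , eq₂ = cong₂ _∷_ (between-injective ≤-refl ≤-refl t u eq₁) (treesSeq-injective f g eq₂)

countOnes-forestSeq : ∀ f → countOnes (forestSeq f) ≡ suc (length f)
countOnes-forestSeq []      = refl
countOnes-forestSeq (t ∷ f) = begin
  suc (length (filter (_≟ 1) (between 1 1 t ++ forestSeq f)))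
    ≡⟨ cong (suc ∘ length) (filter-++ (_≟ 1) (between 1 1 t) (forestSeq f)) ⟩
  suc (length (filter (_≟ 1) (between 1 1 t) ++ filter (_≟ 1) (forestSeq f)))
    ≡⟨ cong (λ xs → suc (length (xs ++ filter (_≟ 1) (forestSeq f)))) (filter-none (_≟ 1) (all-≢ (between-≥ 1 1 t))) ⟩
  suc (countOnes (forestSeq f))
    ≡⟨ cong suc (countOnes-forestSeq f) ⟩
  suc (suc (length f)) ∎
  where open ≡-Reasoning

MiddleDivides : ℕ → List ℕ → Set
MiddleDivides x (y ∷ z ∷ _) = y ∣ x + z
MiddleDivides x _           = ⊤

DividesNeighbours : List ℕ → Set
DividesNeighbours []      = ⊤
DividesNeighbours (x ∷ l) = MiddleDivides x l × DividesNeighbours l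

lastOr : ℕ → List ℕ → ℕ
lastOr d []      = d
lastOr d (x ∷ l) = lastOr x l

between-head : ∀ a b t → ∃ λ j → ∀ ys → ∃ λ zs → between a b t ++ b ∷ ys ≡ (b + j * a) ∷ zs
between-head a b leaf       = 0 , λ ys → ys , cong (_∷ ys) (sym (+-identityʳ b))
between-head a b (node l r) with between-head a (a + b) l
... | j , head-l = suc j , λ ys → let (zs , eq) = head-l (between (a + b) b r ++ b ∷ ys) in
  zs , trans (++-assoc (between a (a + b) l) ((a + b) ∷ between (a + b) b r) (b ∷ ys))
             (trans eq (cong (_∷ zs) (shuffle a b j)))
  where
  shuffle : ∀ a b j → a + b + j * a ≡ b + (a + j * a)
  shuffle = solve-∀

between-last : ∀ a b t → ∃ λ j → ∀ xs → ∃ λ zs → xs ++ a ∷ between a b t ≡ zs ++ (a + j * b) ∷ []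
between-last a b leaf       = 0 , λ xs → xs , cong (λ c → xs ++ c ∷ []) (sym (+-identityʳ a))
between-last a b (node l r) with between-last (a + b) b r
... | j , last-r = suc j , λ xs → let (zs , eq) = last-r (xs ++ a ∷ between a (a + b) l) in
  zs , trans (sym (++-assoc xs (a ∷ between a (a + b) l) ((a + b) ∷ between (a + b) b r)))
             (trans eq (cong (λ c → zs ++ c ∷ []) (shuffle a b j)))
  where
  shuffle : ∀ a b j → a + b + j * b ≡ a + (b + j * b)
  shuffle = solve-∀

DividesNeighbours-glue : ∀ xs m ys → DividesNeighbours (xs ++ m ∷ []) → DividesNeighbours (m ∷ ys) →
  (∀ p q xs′ ys′ → xs ≡ xs′ ++ p ∷ [] → ys ≡ q ∷ ys′ → m ∣ p + q) →
  DividesNeighbours (xs ++ m ∷ ys)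
DividesNeighbours-glue []               m ys       _        dn-ys _      = dn-ys
DividesNeighbours-glue (x ∷ [])         m []       _        dn-ys _      = tt , dn-ys
DividesNeighbours-glue (x ∷ [])         m (q ∷ ys) _        dn-ys middle = middle x q [] ys refl refl , dn-ys
DividesNeighbours-glue (x ∷ y ∷ [])     m ys       (h , dn) dn-ys middle =
  h , DividesNeighbours-glue (y ∷ []) m ys dn dn-ys (λ p q xs′ ys′ eq → middle p q (x ∷ xs′) ys′ (cong (x ∷_) eq))
DividesNeighbours-glue (x ∷ y ∷ z ∷ xs) m ys       (h , dn) dn-ys middle =
  h , DividesNeighbours-glue (y ∷ z ∷ xs) m ys dn dn-ys (λ p q xs′ ys′ eq → middle p q (x ∷ xs′) ys′ (cong (x ∷_) eq))

-- The neighbours of the inserted entry c = a + b are ≡ a and ≡ b modulo c, so c divides their sum.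
between-divisible : ∀ a b t → DividesNeighbours (a ∷ between a b t ++ b ∷ [])
between-divisible a b leaf       = tt , tt , tt
between-divisible a b (node l r) =
  subst DividesNeighbours (cong (a ∷_) (sym (++-assoc (between a c l) (c ∷ between c b r) (b ∷ []))))
    (DividesNeighbours-glue (a ∷ between a c l) c (between c b r ++ b ∷ [])
      (between-divisible a c l) (between-divisible c b r) middle)
  where
  c = a + b
  middle : ∀ p q xs′ ys′ → a ∷ between a c l ≡ xs′ ++ p ∷ [] → between c b r ++ b ∷ [] ≡ q ∷ ys′ → c ∣ p + q
  middle p q xs′ ys′ eq-p eq-q with between-last a c l | between-head c b r
  ... | i , last-l | j , head-r with last-l [] | head-r []
  ... | zs , eq-l | ws , eq-r
    with proj₂ (∷ʳ-injective xs′ zs (trans (sym eq-p) eq-l)) | proj₁ (∷-injective (trans (sym eq-q) eq-r))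
  ... | refl | refl = divides (suc (i + j)) (shuffle a b i j)
    where
    shuffle : ∀ a b i j → a + i * (a + b) + (b + j * (a + b)) ≡ suc (i + j) * (a + b)
    shuffle = solve-∀

forestSeq-divisible : ∀ f → DividesNeighbours (forestSeq f)
forestSeq-divisible []      = tt , tt
forestSeq-divisible (t ∷ f) = DividesNeighbours-glue (1 ∷ between 1 1 t) 1 (treesSeq f)
  (between-divisible 1 1 t) (forestSeq-divisible f) (λ p q _ _ _ _ → 1∣ (p + q))

forestSeq-positive : ∀ f → All (1 ≤_) (forestSeq f)
forestSeq-positive []      = ≤-refl ∷ []
forestSeq-positive (t ∷ f) =
  ≤-refl ∷ Allₚ.++⁺ (All.map (≤-trans (s≤s z≤n)) (between-≥ 1 1 t)) (forestSeq-positive f)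

lastOr-++ : ∀ d (xs : List ℕ) y ys → lastOr d (xs ++ y ∷ ys) ≡ lastOr y ys
lastOr-++ d []       y ys = refl
lastOr-++ d (x ∷ xs) y ys = lastOr-++ x xs y ys

forestSeq-last : ∀ f → lastOr 0 (forestSeq f) ≡ 1
forestSeq-last []      = refl
forestSeq-last (t ∷ f) = trans (lastOr-++ 1 (between 1 1 t) 1 (treesSeq f)) (forestSeq-last f)

record ArithSeq (l : List ℕ) : Set where
  constructor arithSeq
  field
    positive : All (1 ≤_) l
    dividesNeighbours : DividesNeighbours l
    head≡1 : ∃ λ r → l ≡ 1 ∷ r
    last≡1 : lastOr 0 l ≡ 1

forestSeq-ArithSeq : ∀ f → ArithSeq (forestSeq f)
forestSeq-ArithSeq f = arithSeq (forestSeq-positive f) (forestSeq-divisible f) (treesSeq f , refl) (forestSeq-last f)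

data Insertion : List ℕ → List ℕ → Set where
  insert-here  : ∀ a c v → Insertion (a ∷ c ∷ v) (a ∷ (a + c) ∷ c ∷ v)
  insert-there : ∀ x {l l′} → Insertion l l′ → Insertion (x ∷ l) (x ∷ l′)

insertion-at : ∀ u a c v → Insertion (u ++ a ∷ c ∷ v) (u ++ a ∷ (a + c) ∷ c ∷ v)
insertion-at []      a c v = insert-here a c v
insertion-at (x ∷ u) a c v = insert-there x (insertion-at u a c v)

insertion-head : ∀ {m ys l} → Insertion (m ∷ ys) l → ∃ λ ys′ → l ≡ m ∷ ys′
insertion-head (insert-here a c v)  = _ , refl
insertion-head (insert-there x ins) = _ , refl

insertion-split : ∀ (xs : List ℕ) m ys l → Insertion (xs ++ m ∷ ys) l →
  (∃ λ xs′ → Insertion (xs ++ m ∷ []) (xs′ ++ m ∷ []) × l ≡ xs′ ++ m ∷ ys) ⊎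
  (∃ λ ys′ → Insertion (m ∷ ys) (m ∷ ys′) × l ≡ xs ++ m ∷ ys′)
insertion-split [] m ys l ins with insertion-head ins
... | ys′ , refl = inj₂ (ys′ , ins , refl)
insertion-split (x ∷ []) m ys _ (insert-here .x .m .ys) = inj₁ (x ∷ (x + m) ∷ [] , insert-here x m [] , refl)
insertion-split (x ∷ []) m ys _ (insert-there .x ins) with insertion-head ins
... | ys′ , refl = inj₂ (ys′ , ins , refl)
insertion-split (x ∷ y ∷ xs) m ys _ (insert-here .x .y ._) =
  inj₁ (x ∷ (x + y) ∷ y ∷ xs , insert-here x y (xs ++ m ∷ []) , refl)
insertion-split (x ∷ y ∷ xs) m ys _ (insert-there .x ins) with insertion-split (y ∷ xs) m ys _ ins
... | inj₁ (xs′ , ins′ , refl) = inj₁ (x ∷ xs′ , insert-there x ins′ , refl)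
... | inj₂ (ys′ , ins′ , refl) = inj₂ (ys′ , ins′ , refl)

between-insertion : ∀ a b t l → Insertion (a ∷ between a b t ++ b ∷ []) l → ∃ λ t′ → l ≡ a ∷ between a b t′ ++ b ∷ []
between-insertion a b leaf _ (insert-here .a .b .[])                 = node leaf leaf , refl
between-insertion a b leaf _ (insert-there .a (insert-there .b ()))
between-insertion a b (node l r) s ins
  with insertion-split (a ∷ between a (a + b) l) (a + b) (between (a + b) b r ++ b ∷ []) s
         (subst (λ xs → Insertion xs s) (cong (a ∷_) (++-assoc (between a (a + b) l) _ (b ∷ []))) ins)
... | inj₁ (xs′ , ins′ , refl) with between-insertion a (a + b) l (xs′ ++ (a + b) ∷ []) ins′
...   | l′ , eq with ∷ʳ-injective xs′ (a ∷ between a (a + b) l′) eq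
...     | refl , _ = node l′ r , cong (a ∷_) (sym (++-assoc (between a (a + b) l′) ((a + b) ∷ between (a + b) b r) (b ∷ [])))
between-insertion a b (node l r) s ins | inj₂ (ys′ , ins′ , refl)
  with between-insertion (a + b) b r ((a + b) ∷ ys′) ins′
... | r′ , eq with ∷-injective eq
...   | _ , refl = node l r′ , cong (a ∷_) (sym (++-assoc (between a (a + b) l) ((a + b) ∷ between (a + b) b r′) (b ∷ [])))

forestSeq-insertion : ∀ f l → Insertion (forestSeq f) l → ∃ λ f′ → forestSeq f′ ≡ l
forestSeq-insertion []      _ (insert-there .1 ())
forestSeq-insertion (t ∷ f) l ins with insertion-split (1 ∷ between 1 1 t) 1 (treesSeq f) l ins
... | inj₁ (xs′ , ins′ , refl) with between-insertion 1 1 t (xs′ ++ 1 ∷ []) ins′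
...   | t′ , eq with ∷ʳ-injective xs′ (1 ∷ between 1 1 t′) eq
...     | refl , _ = t′ ∷ f , refl
forestSeq-insertion (t ∷ f) l ins | inj₂ (ys′ , ins′ , refl) with forestSeq-insertion f (1 ∷ ys′) ins′
... | f′ , eq with ∷-injective eq
...   | _ , refl = t ∷ f′ , refl

-- Smoothing descents

record Descent (l : List ℕ) : Set where
  constructor descent
  field
    u : List ℕ
    a b c : ℕ
    v : List ℕ
    split : l ≡ u ++ a ∷ b ∷ c ∷ v
    a≤b : a ≤ b
    c<b : c < b

nondecreasing-or-descent : ∀ x y L → x ≤ y → Linked _≤_ (y ∷ L) ⊎ Descent (x ∷ y ∷ L)
nondecreasing-or-descent x y []      _   = inj₁ [-]
nondecreasing-or-descent x y (z ∷ L) x≤y with y ≤? z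
... | no y≰z = inj₂ (descent [] x y z L refl x≤y (≰⇒> y≰z))
... | yes y≤z with nondecreasing-or-descent y z L y≤z
...   | inj₁ nondecreasing = inj₁ (y≤z ∷ nondecreasing)
...   | inj₂ (descent u a b c v split a≤b c<b) = inj₂ (descent (x ∷ u) a b c v (cong (x ∷_) split) a≤b c<b)

nondecreasing-≤-last : ∀ {y L} → Linked _≤_ (y ∷ L) → y ≤ lastOr y L
nondecreasing-≤-last [-]           = ≤-refl
nondecreasing-≤-last (y≤z ∷ y∷L↑) = ≤-trans y≤z (nondecreasing-≤-last y∷L↑)

nondecreasing-to-1 : ∀ {y L} → All (1 ≤_) (y ∷ L) → Linked _≤_ (y ∷ L) → lastOr y L ≡ 1 → All (_≡ 1) (y ∷ L)
nondecreasing-to-1 {y} {[]}    (1≤y ∷ _)   _           last≡1 = last≡1 ∷ []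
nondecreasing-to-1 {y} {z ∷ L} (1≤y ∷ pos) y∷L↑@(_ ∷ z∷L↑) last≡1 =
  ≤-antisym (≤-trans (nondecreasing-≤-last y∷L↑) (≤-reflexive last≡1)) 1≤y ∷ nondecreasing-to-1 pos z∷L↑ last≡1

ones-treesSeq : ∀ r → All (_≡ 1) r → treesSeq (replicate (length r) leaf) ≡ r
ones-treesSeq []      _            = refl
ones-treesSeq (x ∷ r) (refl ∷ ones) = cong (1 ∷_) (ones-treesSeq r ones)

DividesNeighbours-at : ∀ u a b c v → DividesNeighbours (u ++ a ∷ b ∷ c ∷ v) → b ∣ a + c
DividesNeighbours-at []      a b c v (b∣a+c , _) = b∣a+c
DividesNeighbours-at (x ∷ u) a b c v (_ , dn)    = DividesNeighbours-at u a b c v dn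

-- Removing a + c from between a and c keeps the neighbour sums of a and c unchanged modulo a and c respectively.
DividesNeighbours-remove : ∀ u a c v → DividesNeighbours (u ++ a ∷ (a + c) ∷ c ∷ v) → DividesNeighbours (u ++ a ∷ c ∷ v)
DividesNeighbours-remove []  a c []      (_ , _ , dn)          = tt , dn
DividesNeighbours-remove []  a c (e ∷ v) (_ , c∣a+c+e , dn)    =
  ∣m+n∣m⇒∣n (subst (c ∣_) (shuffle a c e) c∣a+c+e) ∣-refl , dn
  where
  shuffle : ∀ a c e → a + c + e ≡ c + (a + e)
  shuffle = solve-∀
DividesNeighbours-remove (x ∷ []) a c v (a∣x+a+c , dn)         =
  ∣m+n∣m⇒∣n (subst (a ∣_) (shuffle x a c) a∣x+a+c) ∣-refl , DividesNeighbours-remove [] a c v dn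
  where
  shuffle : ∀ x a c → x + (a + c) ≡ a + (x + c)
  shuffle = solve-∀
DividesNeighbours-remove (x ∷ y ∷ [])    a c v (h , dn) = h , DividesNeighbours-remove (y ∷ []) a c v dn
DividesNeighbours-remove (x ∷ y ∷ z ∷ u) a c v (h , dn) = h , DividesNeighbours-remove (y ∷ z ∷ u) a c v dn

divides-sum⇒≡ : ∀ {a b c} → b ∣ a + c → a ≤ b → c < b → 1 ≤ c → b ≡ a + c
divides-sum⇒≡ {a} {b} {c} (divides zero a+c≡0) _ _ 1≤c =
  ⊥-elim (<-irrefl refl (≤-trans 1≤c (subst (c ≤_) a+c≡0 (m≤n+m c a))))
divides-sum⇒≡ {a} {b} {c} (divides (suc zero) a+c≡b) _ _ _ = sym (trans a+c≡b (+-identityʳ b))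
divides-sum⇒≡ {a} {b} {c} (divides (suc (suc q)) a+c≡qb) a≤b c<b _ =
  ⊥-elim (<-irrefl refl (<-≤-trans (+-mono-≤-< a≤b c<b) (≤-trans (m≤m+n (b + b) (q * b)) (≤-reflexive (trans (shuffle b q) (sym a+c≡qb))))))
  where
  shuffle : ∀ b q → b + b + q * b ≡ suc (suc q) * b
  shuffle = solve-∀

ArithSeq-remove : ∀ u a c v → ArithSeq (u ++ a ∷ (a + c) ∷ c ∷ v) → ArithSeq (u ++ a ∷ c ∷ v)
ArithSeq-remove u a c v (arithSeq pos dn head≡1 last≡1) = arithSeq
  (Allₚ.++⁺ (Allₚ.++⁻ˡ u pos) (All.head rest ∷ All.tail (All.tail rest)))
  (DividesNeighbours-remove u a c v dn)
  (head-remove u head≡1)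
  (trans (lastOr-++ 0 u a (c ∷ v)) (trans (sym (lastOr-++ 0 u a ((a + c) ∷ c ∷ v))) last≡1))
  where
  rest = Allₚ.++⁻ʳ u pos
  head-remove : ∀ u → (∃ λ r → u ++ a ∷ (a + c) ∷ c ∷ v ≡ 1 ∷ r) → ∃ λ r → u ++ a ∷ c ∷ v ≡ 1 ∷ r
  head-remove []      (_ , refl) = c ∷ v , refl
  head-remove (x ∷ u) (_ , refl) = u ++ a ∷ c ∷ v , refl

length-remove : ∀ (u : List ℕ) a b w → length (u ++ a ∷ b ∷ w) ≡ suc (length (u ++ a ∷ w))
length-remove []      a b w = refl
length-remove (x ∷ u) a b w = cong suc (length-remove u a b w)

-- A descent a ≤ b > c forces b = a + c, so b can be removed; reinserting it corresponds to growing a tree.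
descent-removal : ∀ {l} → ArithSeq l → Descent l →
  ∃ λ l′ → ArithSeq l′ × length l ≡ suc (length l′) × (∀ f → forestSeq f ≡ l′ → ∃ λ f′ → forestSeq f′ ≡ l)
descent-removal s@(arithSeq pos dn _ _) (descent u a b c v refl a≤b c<b)
  with divides-sum⇒≡ (DividesNeighbours-at u a b c v dn) a≤b c<b (All.head (All.tail (All.tail (Allₚ.++⁻ʳ u pos))))
... | refl = u ++ a ∷ c ∷ v , ArithSeq-remove u a c v s , length-remove u a (a + c) (c ∷ v) ,
  λ f f↦ → forestSeq-insertion f _ (subst (λ l → Insertion l (u ++ a ∷ (a + c) ∷ c ∷ v)) (sym f↦) (insertion-at u a c v))

forestSeq-surjective : ∀ n {l} → ArithSeq l → length l ≡ n → ∃ λ f → forestSeq f ≡ l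
forestSeq-surjective _       (arithSeq _ _ ([] , refl) _)    _ = [] , refl
forestSeq-surjective zero    (arithSeq _ _ (_ ∷ _ , refl) _) ()
forestSeq-surjective (suc n) s@(arithSeq pos _ (y ∷ L , refl) last≡1) len
  with nondecreasing-or-descent 1 y L (All.head (All.tail pos))
... | inj₁ nondecreasing = replicate (length (y ∷ L)) leaf ,
  cong (1 ∷_) (ones-treesSeq (y ∷ L) (nondecreasing-to-1 (All.tail pos) nondecreasing last≡1))
... | inj₂ d with descent-removal s d
... | l′ , s′ , len′ , reinsert with forestSeq-surjective n s′ (suc-injective (trans (sym len′) len))
... | f , f↦ = reinsert f f↦

arithSeqs-HasCount : ∀ t q {m} → HasCount (ForestOf t q) m →
  HasCount (λ l → ArithSeq l × length l ≡ suc (t + q) × countOnes l ≡ suc t) m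
arithSeqs-HasCount t q = HasCount-map forestSeq preserves injective surjective
  where
  preserves : ∀ f → ForestOf t q f → ArithSeq (forestSeq f) × length (forestSeq f) ≡ suc (t + q) × countOnes (forestSeq f) ≡ suc t
  preserves f (refl , refl) = forestSeq-ArithSeq f , length-forestSeq f , countOnes-forestSeq f
  injective : ∀ {f g} → ForestOf t q f → ForestOf t q g → forestSeq f ≡ forestSeq g → f ≡ g
  injective {f} {g} _ _ eq = treesSeq-injective f g (∷-injectiveʳ eq)
  surjective : ∀ {l} → ArithSeq l × length l ≡ suc (t + q) × countOnes l ≡ suc t → ∃ λ f → ForestOf t q f × forestSeq f ≡ l
  surjective (s , len , ones) with forestSeq-surjective _ s refl
  ... | f , refl = f , (trees , nodes) , refl
    where
    trees : length f ≡ t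
    trees = suc-injective (trans (sym (countOnes-forestSeq f)) ones)
    nodes : forestSize f ≡ q
    nodes = +-cancelˡ-≡ t _ _ (suc-injective
      (trans (cong (λ m → suc (m + forestSize f)) (sym trees)) (trans (sym (length-forestSeq f)) len)))

-- Arithmetical structures as sequences

entry : List ℕ → ℕ → ℕ
entry []      _       = 0
entry (x ∷ l) zero    = x
entry (x ∷ l) (suc i) = entry l i

neighbourSum : List ℕ → ℕ → ℕ
neighbourSum l i = entry (0 ∷ l) i + entry l (suc i)

lookup-entry : ∀ {n} (r : Vec ℕ n) i → lookup r i ≡ entry (toList r) (toℕ i)
lookup-entry (x ∷ r) fzero    = refl
lookup-entry (x ∷ r) (fsuc i) = lookup-entry r i

toList-tabulate-entry : ∀ {n} l → length l ≡ n → toList (tabulate {n = n} (entry l ∘ toℕ)) ≡ l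
toList-tabulate-entry []      refl = refl
toList-tabulate-entry (x ∷ l) refl = cong (x ∷_) (toList-tabulate-entry l refl)

tabulate-entry-toList : ∀ {n} (r : Vec ℕ n) → tabulate (entry (toList r) ∘ toℕ) ≡ r
tabulate-entry-toList r = trans (V.tabulate-cong (λ i → sym (lookup-entry r i))) (V.tabulate∘lookup r)

adjacent : ℕ → ℕ → ℕ
adjacent a b with suc a ≡ᵇ b | suc b ≡ᵇ a
... | true  | _     = 1
... | false | true  = 1
... | false | false = 0

pathAdj-adjacent : ∀ n (i j : Fin n) → pathAdj n i j ≡ adjacent (toℕ i) (toℕ j)
pathAdj-adjacent n i j with suc (toℕ i) ≡ᵇ toℕ j | suc (toℕ j) ≡ᵇ toℕ i
... | true  | _     = refl
... | false | true  = refl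
... | false | false = refl

adjacent-suc : ∀ a b → adjacent (suc a) (suc b) ≡ adjacent a b
adjacent-suc a b with suc a ≡ᵇ b | suc b ≡ᵇ a
... | true  | _     = refl
... | false | true  = refl
... | false | false = refl

weightedSum : (ℕ → ℕ) → List ℕ → ℕ
weightedSum w []      = 0
weightedSum w (x ∷ l) = w 0 * x + weightedSum (w ∘ suc) l

sum-tabulate-weighted : ∀ {n} w (r : Vec ℕ n) → V.sum (tabulate (λ j → w (toℕ j) * lookup r j)) ≡ weightedSum w (toList r)
sum-tabulate-weighted w []      = refl
sum-tabulate-weighted w (x ∷ r) = cong (w 0 * x +_) (sum-tabulate-weighted (w ∘ suc) r)

weightedSum-cong : ∀ {w w′} → (∀ i → w i ≡ w′ i) → ∀ l → weightedSum w l ≡ weightedSum w′ l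
weightedSum-cong w≗w′ []      = refl
weightedSum-cong w≗w′ (x ∷ l) = cong₂ _+_ (cong (_* x) (w≗w′ 0)) (weightedSum-cong (w≗w′ ∘ suc) l)

weightedSum-zero : ∀ {w} → (∀ i → w i ≡ 0) → ∀ l → weightedSum w l ≡ 0
weightedSum-zero w≗0 []      = refl
weightedSum-zero w≗0 (x ∷ l) = cong₂ _+_ (cong (_* x) (w≗0 0)) (weightedSum-zero (w≗0 ∘ suc) l)

weightedSum-adjacent : ∀ c l → weightedSum (adjacent c) l ≡ neighbourSum l c
weightedSum-adjacent zero          []          = refl
weightedSum-adjacent (suc c)       []          = refl
weightedSum-adjacent zero          (x ∷ [])    = refl
weightedSum-adjacent zero          (x ∷ y ∷ l) =
  trans (cong₂ _+_ (+-identityʳ y) (weightedSum-zero (λ _ → refl) l)) (+-identityʳ y)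
weightedSum-adjacent (suc c)       (x ∷ l)     =
  trans (cong (adjacent (suc c) 0 * x +_) (trans (weightedSum-cong (adjacent-suc c) l) (weightedSum-adjacent c l)))
        (shift c)
  where
  shift : ∀ c → adjacent (suc c) 0 * x + neighbourSum l c ≡ neighbourSum (x ∷ l) (suc c)
  shift zero    = cong (_+ entry l 1) (+-identityʳ x)
  shift (suc c) = refl

adjMul-neighbourSum : ∀ n (r : Vec ℕ n) i → adjMul n r i ≡ neighbourSum (toList r) (toℕ i)
adjMul-neighbourSum n r i = begin
  V.sum (tabulate (λ j → pathAdj n i j * lookup r j))
    ≡⟨ cong V.sum (V.tabulate-cong (λ j → cong (_* lookup r j) (pathAdj-adjacent n i j))) ⟩
  V.sum (tabulate (λ j → adjacent (toℕ i) (toℕ j) * lookup r j))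
    ≡⟨ sum-tabulate-weighted (adjacent (toℕ i)) r ⟩
  weightedSum (adjacent (toℕ i)) (toList r)
    ≡⟨ weightedSum-adjacent (toℕ i) (toList r) ⟩
  neighbourSum (toList r) (toℕ i) ∎
  where open ≡-Reasoning

pad : List ℕ → List ℕ
pad l = 0 ∷ l ++ 0 ∷ []

entry-++-0 : ∀ l i → entry (l ++ 0 ∷ []) i ≡ entry l i
entry-++-0 []      zero    = refl
entry-++-0 []      (suc i) = refl
entry-++-0 (x ∷ l) zero    = refl
entry-++-0 (x ∷ l) (suc i) = entry-++-0 l i

length-pad : ∀ l → length (pad l) ≡ suc (suc (length l))
length-pad l = cong suc (trans (length-++ l) (+-comm (length l) 1))

DividesNeighbours⇒entries : ∀ L → DividesNeighbours L →
  ∀ i → suc (suc i) < length L → entry L (suc i) ∣ entry L i + entry L (suc (suc i))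
DividesNeighbours⇒entries (x ∷ y ∷ z ∷ L) (h , _)  zero    _         = h
DividesNeighbours⇒entries (x ∷ y ∷ z ∷ L) (_ , dn) (suc i) (s≤s i<) = DividesNeighbours⇒entries (y ∷ z ∷ L) dn i i<
DividesNeighbours⇒entries (x ∷ [])        _ _ (s≤s ())
DividesNeighbours⇒entries (x ∷ y ∷ [])    _ _ (s≤s (s≤s ()))

entries⇒DividesNeighbours : ∀ L → (∀ i → suc (suc i) < length L → entry L (suc i) ∣ entry L i + entry L (suc (suc i))) →
  DividesNeighbours L
entries⇒DividesNeighbours []              _ = tt
entries⇒DividesNeighbours (x ∷ [])        _ = tt , tt
entries⇒DividesNeighbours (x ∷ y ∷ [])    _ = tt , tt , tt
entries⇒DividesNeighbours (x ∷ y ∷ z ∷ L) h =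
  h 0 (s≤s (s≤s (s≤s z≤n))) , entries⇒DividesNeighbours (y ∷ z ∷ L) (λ i i< → h (suc i) (s≤s i<))

pad-DividesNeighbours⇔ : ∀ l → DividesNeighbours (pad l) ⇔ (∀ i → i < length l → entry l i ∣ neighbourSum l i)
pad-DividesNeighbours⇔ l = mk⇔
  (λ dn i i<l → subst₂ _∣_ (entry-++-0 l i) (cong₂ _+_ (entry-++-0 (0 ∷ l) i) (entry-++-0 l (suc i)))
     (DividesNeighbours⇒entries (pad l) dn i (subst (suc (suc (suc i)) ≤_) (sym (length-pad l)) (s≤s (s≤s i<l)))))
  (λ h → entries⇒DividesNeighbours (pad l) (λ i i< →
     subst₂ _∣_ (sym (entry-++-0 l i)) (sym (cong₂ _+_ (entry-++-0 (0 ∷ l) i) (entry-++-0 l (suc i))))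
       (h i (≤-pred (≤-pred (subst (suc (suc (suc i)) ≤_) (length-pad l) i<))))))

DividesNeighbours-prefix : ∀ xs ys → DividesNeighbours (xs ++ ys) → DividesNeighbours xs
DividesNeighbours-prefix []              ys _        = tt
DividesNeighbours-prefix (x ∷ [])        ys _        = tt , tt
DividesNeighbours-prefix (x ∷ y ∷ [])    ys (_ , _)  = tt , tt , tt
DividesNeighbours-prefix (x ∷ y ∷ z ∷ xs) ys (h , dn) = h , DividesNeighbours-prefix (y ∷ z ∷ xs) ys dn

common-divisor-rightwards : ∀ {g} p q L → DividesNeighbours (p ∷ q ∷ L) → g ∣ p → g ∣ q → All (g ∣_) L
common-divisor-rightwards p q []      _        _   _   = []
common-divisor-rightwards p q (z ∷ L) (h , dn) g∣p g∣q = g∣z ∷ common-divisor-rightwards q z L dn g∣q g∣z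
  where g∣z = ∣m+n∣m⇒∣n (∣-trans g∣q h) g∣p

common-divisor-leftwards : ∀ {g} L p q → DividesNeighbours (L ++ p ∷ q ∷ []) → g ∣ p → g ∣ q → All (g ∣_) L
common-divisor-leftwards []      p q _ _ _ = []
common-divisor-leftwards {g} (z ∷ L) p q (h , dn) g∣p g∣q with common-divisor-leftwards L p q dn g∣p g∣q
... | g∣L = divides-first L h g∣L ∷ g∣L
  where
  divides-first : ∀ L → MiddleDivides z (L ++ p ∷ q ∷ []) → All (g ∣_) L → g ∣ z
  divides-first []          h _                = ∣m+n∣m⇒∣n (subst (g ∣_) (+-comm z q) (∣-trans g∣p h)) g∣q
  divides-first (s ∷ [])    h (g∣s ∷ _)        = ∣m+n∣m⇒∣n (subst (g ∣_) (+-comm z p) (∣-trans g∣s h)) g∣p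
  divides-first (s ∷ t ∷ L) h (g∣s ∷ g∣t ∷ _) = ∣m+n∣m⇒∣n (subst (g ∣_) (+-comm z t) (∣-trans g∣s h)) g∣t

∣-foldr-gcd : ∀ {g} L → All (g ∣_) L → g ∣ foldr gcd 0 L
∣-foldr-gcd []      []            = _ ∣0
∣-foldr-gcd (x ∷ L) (g∣x ∷ g∣L) = gcd-greatest g∣x (∣-foldr-gcd L g∣L)

init-last : ∀ d l → ∃ λ init → d ∷ l ≡ init ++ lastOr d l ∷ []
init-last d []      = [] , refl
init-last d (x ∷ l) with init-last x l
... | init , eq = d ∷ init , cong (d ∷_) eq

-- An end entry divides its padding neighbour 0, hence every entry, hence the gcd 1.
primitive-ArithSeq : ∀ x l → foldr gcd 0 (x ∷ l) ≡ 1 → DividesNeighbours (pad (x ∷ l)) → All (1 ≤_) (x ∷ l) →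
  ArithSeq (x ∷ l)
primitive-ArithSeq x l gcd≡1 dn pos =
  arithSeq pos (DividesNeighbours-prefix (x ∷ l) (0 ∷ []) (proj₂ dn)) (l , cong (_∷ l) x≡1) last≡1
  where
  divides-all⇒≡1 : ∀ {g} → All (g ∣_) (x ∷ l) → g ≡ 1
  divides-all⇒≡1 {g} g∣ = ∣1⇒≡1 (subst (g ∣_) gcd≡1 (∣-foldr-gcd (x ∷ l) g∣))
  x≡1 : x ≡ 1
  x≡1 = divides-all⇒≡1 (∣-refl ∷ Allₚ.++⁻ˡ l (common-divisor-rightwards 0 x (l ++ 0 ∷ []) dn (x ∣0) ∣-refl))
  last≡1 : lastOr x l ≡ 1
  last≡1 with init-last x l
  ... | init , split = divides-all⇒≡1 (subst (All (m ∣_)) (sym split)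
    (Allₚ.++⁺ (All.tail (common-divisor-leftwards (0 ∷ init) m 0 (subst DividesNeighbours padded dn) ∣-refl (m ∣0)))
             (∣-refl ∷ [])))
    where
    m = lastOr x l
    padded : pad (x ∷ l) ≡ (0 ∷ init) ++ m ∷ 0 ∷ []
    padded = cong (0 ∷_) (trans (cong (_++ 0 ∷ []) split) (++-assoc init (m ∷ []) (0 ∷ [])))

ArithSeq-pad : ∀ {l} → ArithSeq l → DividesNeighbours (pad l)
ArithSeq-pad (arithSeq _ dn (r , refl) last≡1) = first r , rest
  where
  first : ∀ r → MiddleDivides 0 (1 ∷ r ++ 0 ∷ [])
  first []      = 1∣ 0
  first (z ∷ r) = 1∣ z
  rest : DividesNeighbours ((1 ∷ r) ++ 0 ∷ [])
  rest with init-last 1 r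
  ... | init , split = subst DividesNeighbours
    (trans (sym (++-assoc init (1 ∷ []) (0 ∷ []))) (cong (_++ 0 ∷ []) (sym split′)))
    (DividesNeighbours-glue init 1 (0 ∷ []) (subst DividesNeighbours split′ dn) (tt , tt , tt) (λ p q _ _ _ _ → 1∣ (p + q)))
    where
    split′ : 1 ∷ r ≡ init ++ 1 ∷ []
    split′ = trans split (cong (λ m → init ++ m ∷ []) last≡1)

All-toList : ∀ {n} {P : ℕ → Set} (r : Vec ℕ n) → (∀ i → P (lookup r i)) → All P (toList r)
All-toList []      _ = []
All-toList (x ∷ r) p = p fzero ∷ All-toList r (p ∘ fsuc)

IsArithStruct⇒entries : ∀ {n d r} → IsArithStruct n (d , r) →
  ∀ i → i < length (toList r) → entry (toList r) i ∣ neighbourSum (toList r) i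
IsArithStruct⇒entries {n} {d} {r} (_ , _ , _ , balanced) i i<length =
  subst₂ (λ a b → entry (toList r) a ∣ neighbourSum (toList r) b) (toℕ-fromℕ< i<n) (toℕ-fromℕ< i<n)
    (subst₂ _∣_ (lookup-entry r j) (adjMul-neighbourSum n r j) (divides (lookup d j) (sym (balanced j))))
  where
  i<n : i < n
  i<n = subst (i <_) (V.length-toList r) i<length
  j = fromℕ< i<n

IsArithStruct⇒ArithSeq : ∀ {n d r} → 1 ≤ n → IsArithStruct n (d , r) → ArithSeq (toList r)
IsArithStruct⇒ArithSeq {d = d} {r = x ∷ r} (s≤s _) s@(_ , pos , gcd≡1 , _) = primitive-ArithSeq x (toList r) gcd≡1
  (Equivalence.from (pad-DividesNeighbours⇔ (x ∷ toList r)) (IsArithStruct⇒entries {d = d} s)) (All-toList (x ∷ r) pos)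

quot : ℕ → ℕ → ℕ
quot m zero    = 0
quot m (suc k) = m / suc k

quot*≡ : ∀ {m k} → 1 ≤ k → k ∣ m → quot m k * k ≡ m
quot*≡ {k = suc k} _ k∣m = m/n*n≡m k∣m

quot-*≡ : ∀ m k → 1 ≤ k → quot (m * k) k ≡ m
quot-*≡ m (suc k) _ = m*n/n≡m m (suc k)

structure : ∀ n → List ℕ → Vec ℕ n × Vec ℕ n
structure n l = tabulate (λ i → quot (neighbourSum l (toℕ i)) (entry l (toℕ i))) , tabulate (entry l ∘ toℕ)

entry-positive : ∀ {l} → All (1 ≤_) l → ∀ {i} → i < length l → 1 ≤ entry l i
entry-positive (p ∷ _)  {zero}  _        = p
entry-positive (_ ∷ ps) {suc i} (s≤s i<) = entry-positive ps i<

ArithSeq⇒IsArithStruct : ∀ {n l} → 2 ≤ n → length l ≡ n → ArithSeq l → IsArithStruct n (structure n l)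
ArithSeq⇒IsArithStruct {n} {l} 2≤n len s@(arithSeq pos _ (r , refl) _) = d-positive , r-positive , gcd≡1 , balanced
  where
  d = proj₁ (structure n l)
  i<length : ∀ (i : Fin n) → toℕ i < length l
  i<length i = subst (toℕ i <_) (sym len) (toℕ<n i)
  1≤entry : ∀ i → 1 ≤ entry l (toℕ i)
  1≤entry i = entry-positive pos (i<length i)
  r-positive : ∀ i → 1 ≤ lookup (tabulate (entry l ∘ toℕ)) i
  r-positive i = subst (1 ≤_) (sym (V.lookup∘tabulate _ i)) (1≤entry i)
  gcd≡1 : foldr gcd 0 (toList (tabulate {n = n} (entry l ∘ toℕ))) ≡ 1
  gcd≡1 = trans (cong (foldr gcd 0) (toList-tabulate-entry l len)) (gcd-zeroˡ (foldr gcd 0 r))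
  d*r : ∀ i → lookup d i * lookup (tabulate (entry l ∘ toℕ)) i ≡ neighbourSum l (toℕ i)
  d*r i = trans (cong₂ _*_ (V.lookup∘tabulate _ i) (V.lookup∘tabulate _ i)) (quot*≡ (1≤entry i)
    (Equivalence.to (pad-DividesNeighbours⇔ l) (ArithSeq-pad s) (toℕ i) (i<length i)))
  balanced : ∀ i → lookup d i * lookup (tabulate (entry l ∘ toℕ)) i ≡ adjMul n (tabulate (entry l ∘ toℕ)) i
  balanced i = trans (d*r i) (sym (trans (adjMul-neighbourSum n _ i) (cong (λ l′ → neighbourSum l′ (toℕ i)) (toList-tabulate-entry l len))))
  sum-positive : ∀ (i : Fin n) → 1 ≤ neighbourSum l (toℕ i)
  sum-positive i with toℕ i | i<length i
  ... | zero  | _     = ≤-trans (entry-positive pos (subst (1 <_) (sym len) 2≤n)) (m≤n+m _ 0)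
  ... | suc c | c+1<  = ≤-trans (entry-positive pos (<⇒≤ c+1<)) (m≤m+n _ _)
  d-positive : ∀ i → 1 ≤ lookup d i
  d-positive i with lookup d i | d*r i
  ... | zero  | 0≡sum = ⊥-elim (<-irrefl 0≡sum (sum-positive i))
  ... | suc _ | _     = s≤s z≤n

IsArithStruct⇒structure : ∀ {n d r} → IsArithStruct n (d , r) → structure n (toList r) ≡ (d , r)
IsArithStruct⇒structure {n} {d} {r} (_ , r-positive , _ , balanced) =
  cong₂ _,_ (trans (V.tabulate-cong d-entry) (V.tabulate∘lookup d)) (tabulate-entry-toList r)
  where
  d-entry : ∀ i → quot (neighbourSum (toList r) (toℕ i)) (entry (toList r) (toℕ i)) ≡ lookup d i
  d-entry i = begin
    quot (neighbourSum (toList r) (toℕ i)) (entry (toList r) (toℕ i))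
      ≡⟨ cong₂ quot (sym (trans (balanced i) (adjMul-neighbourSum n r i))) (sym (lookup-entry r i)) ⟩
    quot (lookup d i * lookup r i) (lookup r i)
      ≡⟨ quot-*≡ (lookup d i) (lookup r i) (r-positive i) ⟩
    lookup d i ∎
    where open ≡-Reasoning

structures-HasCount : ∀ {n k m} → 2 ≤ n →
  HasCount (λ l → ArithSeq l × length l ≡ n × countOnes l ≡ k) m →
  HasCount (λ (s : Vec ℕ n × Vec ℕ n) → IsArithStruct n s × ones (proj₂ s) ≡ k) m
structures-HasCount {n} {k} 2≤n = HasCount-map (structure n) preserves injective surjective
  where
  preserves : ∀ l → ArithSeq l × length l ≡ n × countOnes l ≡ k →
    IsArithStruct n (structure n l) × ones (proj₂ (structure n l)) ≡ k
  preserves l (s , len , ones≡k) =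
    ArithSeq⇒IsArithStruct 2≤n len s , trans (cong countOnes (toList-tabulate-entry l len)) ones≡k
  injective : ∀ {l l′} → ArithSeq l × length l ≡ n × countOnes l ≡ k → ArithSeq l′ × length l′ ≡ n × countOnes l′ ≡ k →
    structure n l ≡ structure n l′ → l ≡ l′
  injective {l} {l′} (_ , len , _) (_ , len′ , _) eq =
    trans (sym (toList-tabulate-entry l len)) (trans (cong (toList ∘ proj₂) eq) (toList-tabulate-entry l′ len′))
  surjective : ∀ {s} → IsArithStruct n s × ones (proj₂ s) ≡ k →
    ∃ λ l → (ArithSeq l × length l ≡ n × countOnes l ≡ k) × structure n l ≡ s
  surjective {d , r} (s , ones≡k) = toList r ,
    (IsArithStruct⇒ArithSeq {d = d} (≤-trans (s≤s z≤n) 2≤n) s , V.length-toList r , ones≡k) ,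
    IsArithStruct⇒structure {d = d} s

theorem2p9 : (n k : ℕ) → 2 ≤ n → 1 ≤ k → k ≤ n →
    HasCount (λ (s : Vec ℕ n × Vec ℕ n) → IsArithStruct n s × ones (proj₂ s) ≡ k)
             (ballot (n ∸ 2) (n ∸ k))
    × ((n ∸ 1) * ballot (n ∸ 2) (n ∸ k) ≡ (k ∸ 1) * ((2 * n ∸ 2 ∸ k) C (n ∸ 2)))
theorem2p9 zero    (suc _) _   _ ()
theorem2p9 _       zero    _   () _
theorem2p9 (suc n) (suc k) 2≤n _ k≤n@(s≤s k≤n′) = structures-HasCount 2≤n sequences , ballot-formula k≤n
  where
  q = n ∸ k
  forest-count : HasCount (ForestOf k q) (ballot (n ∸ 1) q)
  forest-count = subst (HasCount (ForestOf k q))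
    (trans (length-forests k q) (cong (λ m → ballot (m ∸ 1) q) (m+[n∸m]≡n k≤n′)))
    (forests-HasCount k q)
  sequences : HasCount (λ l → ArithSeq l × length l ≡ suc n × countOnes l ≡ suc k) (ballot (n ∸ 1) q)
  sequences = subst (λ m → HasCount (λ l → ArithSeq l × length l ≡ suc m × countOnes l ≡ suc k) (ballot (n ∸ 1) q))
    (m+[n∸m]≡n k≤n′) (arithSeqs-HasCount k q forest-count)
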